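{- Let $E$ be a propositional variable and $\delta$ a new atomic formula symbol (the fixed point operator of $A(p,E)=E\wedge\neg(\exists x)x:(p\rightarrow E)$). Then $\mathsf{QLP}(\delta\leftrightarrow[E\wedge\neg(\exists x)x:(\delta\rightarrow E)])_{\emptyset}\vdash\neg\delta$, where this logic is $\mathsf{QLP}$ without Axiom Necessitation, over the language extended by $\delta$, with the single additional axiom $\delta\leftrightarrow[E\wedge\neg(\exists x)x:(\delta\rightarrow E)]$.
   Context: Fix countably many justification variables, propositional variables, and primitive function symbols of each arity $n\ge0$; a primitive term is $f(x_1,\dots,x_n)$. Terms of $\mathsf{QLP}$: $t::= x\mid f(x_1,\dots,x_n)\mid t\cdot t\mid t+t\mid !t\mid(t\forall x)$ ($x$ bound in $(t\forall x)$). Formulas: $A::= p\mid\bot\mid\neg A\mid A\wedge A\mid A\vee A\mid A\rightarrow A\mid t:A\mid(\forall x)A\mid(\exists x)A$. Axioms: all propositional tautologies; Q1: $(\forall x)A(x)\rightarrow A(t)$, $t$ free for $x$; Q2: $(\forall x)(A\rightarrow B(x))\rightarrow(A\rightarrow(\forall x)B(x))$, $x$ not free in $A$; Q3: $A(t)\rightarrow(\exists x)A(x)$, $t$ free for $x$; Q4: $(\forall x)(A(x)\rightarrow B)\rightarrow((\exists x)A(x)\rightarrow B)$, $x$ not free in $B$; jK: $s:(A\rightarrow B)\rightarrow(t:A\rightarrow(s\cdot t):B)$; jT: $t:A\rightarrow A$; j4: $t:A\rightarrow !t:t:A$; Sum: $s:A\rightarrow(s+t):A$, $s:A\rightarrow(t+s):A$;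 UF: $(\exists y)y:(\forall x)t:A\rightarrow(t\forall x):(\forall x)A$, $y$ not free in $t$ or $A$. Rules: Modus Ponens; Gen: from $A$ infer $(\forall x)A$; qNec: from $A$ infer $(\exists x)x:A$, $x$ not free in $A$; Axiom Necessitation: from an axiom instance $A$ infer $f(x_1,\dots,x_n):A$. The subscript $\emptyset$ means Axiom Necessitation is dropped. All schemes and rules apply to formulas of the extended language. -}

module Defs where

open import Data.Nat using (ℕ; _≡ᵇ_)
open import Data.Bool using (Bool; true; false; if_then_else_; _∧_; _∨_; not)
open import Data.Vec using (Vec; []; _∷_)
open import Data.Maybe using (Maybe; just; nothing; map; zipWith; _>>=_)
open import Data.Product using (_×_)
open import Relation.Binary.PropositionalEquality using (_≡_)

infixl 7 _·_
infixl 6 _⊕_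
data Tm : Set where
  var  : ℕ → Tm
  fn   : (n i : ℕ) → Vec ℕ n → Tm         -- primitive term f_i^n(x1,…,xn)
  _·_  : Tm → Tm → Tm
  _⊕_  : Tm → Tm → Tm
  !_   : Tm → Tm
  uf   : Tm → ℕ → Tm                      -- (t ∀ x), x bound

infixr 4 _⇒_
infixr 5 _∨̇_
infixr 6 _∧̇_
infix  8 _∶_
data Fm : Set where
  atom : ℕ → Fm
  δ    : Fm
  ⊥̇    : Fm
  ¬̇_   : Fm → Fm
  _∧̇_  : Fm → Fm → Fm
  _∨̇_  : Fm → Fm → Fm
  _⇒_  : Fm → Fm → Fm
  _∶_  : Tm → Fm → Fm
  all  : ℕ → Fm → Fm
  ex   : ℕ → Fm → Fm

infix 3 _⇔_
_⇔_ : Fm → Fm → Fm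
A ⇔ B = (A ⇒ B) ∧̇ (B ⇒ A)

occV : ∀ {n} → ℕ → Vec ℕ n → Bool
occV x []       = false
occV x (y ∷ ys) = (x ≡ᵇ y) ∨ occV x ys

occT : ℕ → Tm → Bool
occT x (var y)     = x ≡ᵇ y
occT x (fn n i ys) = occV x ys
occT x (s · t)     = occT x s ∨ occT x t
occT x (s ⊕ t)     = occT x s ∨ occT x t
occT x (! t)       = occT x t
occT x (uf t y)    = if x ≡ᵇ y then false else occT x t

occ : ℕ → Fm → Bool
occ x (atom p) = false
occ x δ        = false
occ x ⊥̇        = false
occ x (¬̇ A)    = occ x A
occ x (A ∧̇ B)  = occ x A ∨ occ x B
occ x (A ∨̇ B)  = occ x A ∨ occ x B
occ x (A ⇒ B)  = occ x A ∨ occ x B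
occ x (t ∶ A)  = occT x t ∨ occ x A
occ x (all y A) = if x ≡ᵇ y then false else occ x A
occ x (ex y A)  = if x ≡ᵇ y then false else occ x A

NotFree : ℕ → Fm → Set
NotFree x A = occ x A ≡ false

NotFreeT : ℕ → Tm → Set
NotFreeT x t = occT x t ≡ false

-- The result is 'nothing' exactly when t is not free for x in A
-- (a free occurrence of x would be captured by a binder of a variable
-- free in t), or when the result would not be a formula of the language
-- (an argument x of a primitive term f(x1,…,xn) may only be replaced by a
-- variable, since primitive terms have variables as arguments).

subV : ∀ {n} → ℕ → Tm → Vec ℕ n → Maybe (Vec ℕ n)
subV x t [] = just []
subV x t (y ∷ ys) with x ≡ᵇ y | t
... | true  | var z = map (z ∷_) (subV x t ys)
... | true  | _     = nothing
... | false | _     = map (y ∷_) (subV x t ys)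

subT : ℕ → Tm → Tm → Maybe Tm
subT x t (var y)     = if x ≡ᵇ y then just t else just (var y)
subT x t (fn n i ys) = map (fn n i) (subV x t ys)
subT x t (a · b)     = zipWith _·_ (subT x t a) (subT x t b)
subT x t (a ⊕ b)     = zipWith _⊕_ (subT x t a) (subT x t b)
subT x t (! a)       = map !_ (subT x t a)
subT x t (uf a y)    =
  if x ≡ᵇ y then just (uf a y)
  else if occT x a ∧ occT y t then nothing
  else map (λ a' → uf a' y) (subT x t a)

sub : ℕ → Tm → Fm → Maybe Fm
sub x t (atom p) = just (atom p)
sub x t δ        = just δ
sub x t ⊥̇        = just ⊥̇
sub x t (¬̇ A)    = map ¬̇_ (sub x t A)
sub x t (A ∧̇ B)  = zipWith _∧̇_ (sub x t A) (sub x t B)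
sub x t (A ∨̇ B)  = zipWith _∨̇_ (sub x t A) (sub x t B)
sub x t (A ⇒ B)  = zipWith _⇒_ (sub x t A) (sub x t B)
sub x t (s ∶ A)  = zipWith _∶_ (subT x t s) (sub x t A)
sub x t (all y A) =
  if x ≡ᵇ y then just (all y A)
  else if occ x A ∧ occT y t then nothing
  else map (all y) (sub x t A)
sub x t (ex y A) =
  if x ≡ᵇ y then just (ex y A)
  else if occ x A ∧ occT y t then nothing
  else map (ex y) (sub x t A)

-- Propositional tautologies (in the extended language): formulas true
-- under every Boolean valuation of their prime (non-connective)
-- subformulas p, δ, t:A, (∀x)A, (∃x)A.

eval : (Fm → Bool) → Fm → Bool
eval v ⊥̇       = false
eval v (¬̇ A)   = not (eval v A)
eval v (A ∧̇ B) = eval v A ∧ eval v B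
eval v (A ∨̇ B) = eval v A ∨ eval v B
eval v (A ⇒ B) = not (eval v A) ∨ eval v B
eval v A       = v A

Tautology : Fm → Set
Tautology A = (v : Fm → Bool) → eval v A ≡ true

data Axiom : Fm → Set where
  taut : ∀ {A} → Tautology A → Axiom A
  Q1   : ∀ x t A B → sub x t A ≡ just B → Axiom (all x A ⇒ B)
  Q2   : ∀ x A B → NotFree x A →
         Axiom (all x (A ⇒ B) ⇒ (A ⇒ all x B))
  Q3   : ∀ x t A B → sub x t A ≡ just B → Axiom (B ⇒ ex x A)
  Q4   : ∀ x A B → NotFree x B →
         Axiom (all x (A ⇒ B) ⇒ (ex x A ⇒ B))
  jK   : ∀ s t A B → Axiom (s ∶ (A ⇒ B) ⇒ (t ∶ A ⇒ (s · t) ∶ B))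
  jT   : ∀ t A → Axiom (t ∶ A ⇒ A)
  j4   : ∀ t A → Axiom (t ∶ A ⇒ (! t) ∶ (t ∶ A))
  sumˡ : ∀ s t A → Axiom (s ∶ A ⇒ (s ⊕ t) ∶ A)
  sumʳ : ∀ s t A → Axiom (s ∶ A ⇒ (t ⊕ s) ∶ A)
  UF   : ∀ x y t A → NotFreeT y t → NotFree y A →
         Axiom (ex y (var y ∶ all x (t ∶ A)) ⇒ uf t x ∶ all x A)

infix 2 QLP∅[_]⊢_
data QLP∅[_]⊢_ (H : Fm) : Fm → Set where
  ax   : ∀ {A} → Axiom A → QLP∅[ H ]⊢ A
  hyp  : QLP∅[ H ]⊢ H
  mp   : ∀ {A B} → QLP∅[ H ]⊢ (A ⇒ B) → QLP∅[ H ]⊢ A → QLP∅[ H ]⊢ B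
  gen  : ∀ {A} x → QLP∅[ H ]⊢ A → QLP∅[ H ]⊢ all x A
  qNec : ∀ {A} x → NotFree x A → QLP∅[ H ]⊢ A → QLP∅[ H ]⊢ ex x (var x ∶ A)

module Submission where

-- Write  H  for the fixed-point axiom  P ↔ (Q ∧ ¬X)
-- with  X = (∃x) x:(P → Q).  The argument is two propositional steps
-- around a single use of qNec:
--   * H tautologically implies  P → Q, so  P → Q  is a theorem;
--   * qNec internalises that theorem as  X = (∃x) x:(P → Q);
--   * H tautologically implies  X → ¬P, hence  ¬P.
-- The file first shows that tautological consequence is a derived rule,
-- then proves the two tautologies for ARBITRARY formulas P, Q (their truth
-- depends only on the Boolean values of P, Q and X), derives the general
-- refutation of any such fixed point, and finally instantiates it with
-- P = δ and Q = E.

open import Defs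
open import Data.Nat using (ℕ)
open import Data.Bool using (true; false)
open import Relation.Binary.PropositionalEquality using (refl)

taut-mp : ∀ {H A B} → Tautology (A ⇒ B) → QLP∅[ H ]⊢ A → QLP∅[ H ]⊢ B
taut-mp A⇒B ⊢A = mp (ax (taut A⇒B)) ⊢A

fixpoint⇒premise : ∀ P Q R → Tautology ((P ⇔ (Q ∧̇ ¬̇ R)) ⇒ (P ⇒ Q))
fixpoint⇒premise P Q R v with eval v P | eval v Q | eval v R
... | true  | true  | true  = refl
... | true  | true  | false = refl
... | true  | false | true  = refl
... | true  | false | false = refl
... | false | true  | true  = refl
... | false | true  | false = refl
... | false | false | true  = refl
... | false | false | false = refl

fixpoint⇒refute : ∀ P Q R → Tautology ((P ⇔ (Q ∧̇ ¬̇ R)) ⇒ (R ⇒ ¬̇ P))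
fixpoint⇒refute P Q R v with eval v P | eval v Q | eval v R
... | true  | true  | true  = refl
... | true  | true  | false = refl
... | true  | false | true  = refl
... | true  | false | false = refl
... | false | true  | true  = refl
... | false | true  | false = refl
... | false | false | true  = refl
... | false | false | false = refl

-- Every fixed point P of  A(p, Q) = Q ∧ ¬(∃x) x:(p → Q)  is refuted by
-- QLP∅ with the fixed-point axiom, provided x is not free in  P → Q
-- (the side condition of qNec).
fixpoint-refutable : ∀ P Q x → NotFree x (P ⇒ Q) →
  QLP∅[ P ⇔ (Q ∧̇ ¬̇ ex x (var x ∶ (P ⇒ Q))) ]⊢ ¬̇ P
fixpoint-refutable P Q x x∉P⇒Q =
  mp (taut-mp (fixpoint⇒refute P Q R) hyp) ⊢R
  where
  R : Fm
  R = ex x (var x ∶ (P ⇒ Q))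

  ⊢P⇒Q : QLP∅[ P ⇔ (Q ∧̇ ¬̇ R) ]⊢ P ⇒ Q
  ⊢P⇒Q = taut-mp (fixpoint⇒premise P Q R) hyp

  ⊢R : QLP∅[ P ⇔ (Q ∧̇ ¬̇ R) ]⊢ R
  ⊢R = qNec x x∉P⇒Q ⊢P⇒Q

-- The theorem: δ and E contain no justification variables, so x is not
-- free in  δ → E.
theorem27 : (E x : ℕ) →
    QLP∅[ δ ⇔ (atom E ∧̇ ¬̇ ex x (var x ∶ (δ ⇒ atom E))) ]⊢ ¬̇ δ
theorem27 E x = fixpoint-refutable δ (atom E) x refl
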